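{- Let $G$ be a finite group with identity $e$, and let $S,T\subseteq G\setminus\{e\}$ be symmetric subsets. Let $U=G\setminus\{e\}$. Then $A(G;U)=A(G;S)A(G;T)$ holds if and only if $(S,T)$ is a symmetric near-factorization of $G$. In particular, if this identity holds then $|S|\,|T|=|G|-1$ and $S\cap T=\varnothing$.
   Context: A subset $X$ of a group is symmetric if $X^{ -1}=X$. Fix an enumeration $G=\{g_1,\dots,g_n\}$; for $X\subseteq G$, $A(G;X)$ is the $n\times n$ matrix with $(i,j)$ entry $1$ if $g_i^{ -1}g_j\in X$ and $0$ otherwise. A near-factorization of $G$ is a pair $(S,T)$ of subsets with $e\notin S\cup T$ such that every $g\in G\setminus\{e\}$ has a unique representation $g=st$ with $s\in S$, $t\in T$, and no other element of $G$ (i.e. not $e$) is of the form $st$; it is symmetric if $S=S^{ -1}$ and $T=T^{ -1}$. -}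

module Defs where

open import Level using (Level; _⊔_)
open import Data.Nat using (ℕ; zero; suc; _+_; _*_)
open import Data.Fin using (Fin; zero; suc)
open import Data.Bool using (Bool; true; false; if_then_else_)
open import Data.Product using (Σ; _×_; _,_; ∃)
open import Relation.Nullary using (¬_; Dec; does)
open import Relation.Binary.PropositionalEquality using (_≡_)
open import Algebra.Bundles using (Group)
open import Data.Bool using (not)

-- A finite group: a group (with setoid equality _≈_, assumed decidable)
-- together with a fixed enumeration g : Fin n → Carrier which is a bijection
-- (up to _≈_): G = {g_1, …, g_n}.
record FiniteGroup (c ℓ : Level) : Set (Level.suc (c ⊔ ℓ)) where
  field
    group    : Group c ℓ
  open Group group public
  field
    _≟_      : (x y : Carrier) → Dec (x ≈ y)
    n        : ℕ
    enum     : Fin n → Carrier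
    enum-inj : ∀ i j → enum i ≈ enum j → i ≡ j
    enum-sur : ∀ x → ∃ λ i → enum i ≈ x

Σ[<_]_ : (n : ℕ) → (Fin n → ℕ) → ℕ
Σ[< zero ] f = 0
Σ[< suc n ] f = f zero + Σ[< n ] (λ i → f (suc i))

module _ {c ℓ : Level} (FG : FiniteGroup c ℓ) where
  open FiniteGroup FG

  Subset : Set c
  Subset = Carrier → Bool

  Respects : Subset → Set (c ⊔ ℓ)
  Respects X = ∀ x y → x ≈ y → X x ≡ X y

  Symmetric : Subset → Set c
  Symmetric X = ∀ x → X (x ⁻¹) ≡ X x

  U : Subset
  U x = not (does (x ≟ ε))

  card : Subset → ℕ
  card X = Σ[< n ] (λ i → if X (enum i) then 1 else 0)

  Matrix : Set
  Matrix = Fin n → Fin n → ℕ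

  A : Subset → Matrix
  A X i j = if X ((enum i) ⁻¹ ∙ enum j) then 1 else 0

  _⊗_ : Matrix → Matrix → Matrix
  (M ⊗ N) i j = Σ[< n ] (λ k → M i k * N k j)

  _≡ᴹ_ : Matrix → Matrix → Set
  M ≡ᴹ N = ∀ i j → M i j ≡ N i j

  NearFactorization : Subset → Subset → Set (c ⊔ ℓ)
  NearFactorization S T =
      (S ε ≡ false × T ε ≡ false)
    × (∀ g → ¬ (g ≈ ε) →
         Σ Carrier λ s → Σ Carrier λ t →
           (S s ≡ true × T t ≡ true × (s ∙ t) ≈ g)
           × (∀ s′ t′ → S s′ ≡ true → T t′ ≡ true → (s′ ∙ t′) ≈ g →
                (s′ ≈ s × t′ ≈ t)))
    × (∀ s t → S s ≡ true → T t ≡ true → ¬ ((s ∙ t) ≈ ε))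

  SymmetricNearFactorization : Subset → Subset → Set (c ⊔ ℓ)
  SymmetricNearFactorization S T =
    NearFactorization S T × Symmetric S × Symmetric T

  Disjoint : Subset → Subset → Set c
  Disjoint S T = ∀ x → S x ≡ true → T x ≡ false

{-# OPTIONS --safe #-}
-- The (i, j) entry of A(G;S) A(G;T) counts the k with g_i⁻¹ g_k ∈ S and g_k⁻¹ g_j ∈ T, and
-- k ↦ (g_i⁻¹ g_k , g_k⁻¹ g_j) is a bijection from these k onto the factorizations s t of g_i⁻¹ g_j
-- with s ∈ S, t ∈ T.  So A(G;U) = A(G;S) A(G;T) says exactly that e has no such factorization and
-- every other element has exactly one.  Every row of A(G;X) sums to |X|, so summing one row of the
-- identity gives |S| |T| = |G| - 1; and x ∈ S ∩ T would give the forbidden factorization e = x x⁻¹.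
module Submission where

open import Defs
open import Level using (Level; _⊔_)
open import Data.Bool using (Bool; true; false; not; _∧_; if_then_else_)
open import Data.Bool.Properties using (¬-not; not-¬)
open import Data.Empty using (⊥-elim)
open import Data.Fin using (Fin; zero; suc)
open import Data.Fin.Permutation using (Permutation; permutation; _⟨$⟩ʳ_)
open import Data.Fin.Properties using (suc-injective; 0≢1+n)
open import Data.Nat using (ℕ; zero; suc; _+_; _*_; _∸_)
open import Data.Nat.Properties using (+-*-semiring; +-suc; *-identityˡ; m+n∸m≡n)
import Data.Nat.Properties as ℕ
open import Data.Product using (Σ; _×_; _,_; proj₁; proj₂; ∃!)
open import Function using (_∘_)
open import Function.Bundles using (_⇔_; mk⇔; Equivalence)
open import Relation.Nullary using (¬_; Dec; yes; no; does)
open import Relation.Nullary.Decidable using (dec-true; dec-false; does-⇔)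
open import Relation.Binary.PropositionalEquality
  using (_≡_; refl; sym; trans; cong; module ≡-Reasoning)
open import Algebra.Properties.Semiring.Sum +-*-semiring
  using (sum; sum-cong-≗; ∑-comm; sum-permute; *-distribˡ-sum; *-distribʳ-sum)
import Algebra.Properties.Group as GroupProperties

indicator : Bool → ℕ
indicator b = if b then 1 else 0

indicator-∧ : ∀ a b → indicator a * indicator b ≡ indicator (a ∧ b)
indicator-∧ true  b = *-identityˡ (indicator b)
indicator-∧ false b = refl

∧≡true⇔ : ∀ a b → a ∧ b ≡ true ⇔ (a ≡ true × b ≡ true)
∧≡true⇔ true  b = mk⇔ (refl ,_) proj₂
∧≡true⇔ false b = mk⇔ (λ ()) ((λ ()) ∘ proj₁)

Σ≡sum : ∀ {n} (f : Fin n → ℕ) → Σ[< n ] f ≡ sum f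
Σ≡sum {zero}  f = refl
Σ≡sum {suc n} f = cong (f zero +_) (Σ≡sum (f ∘ suc))

Σ-cong : ∀ {n} {f g : Fin n → ℕ} → (∀ k → f k ≡ g k) → Σ[< n ] f ≡ Σ[< n ] g
Σ-cong {f = f} {g} f≗g = trans (Σ≡sum f) (trans (sum-cong-≗ f≗g) (sym (Σ≡sum g)))

Σ-*ʳ : ∀ {n} (f : Fin n → ℕ) c → Σ[< n ] (λ k → f k * c) ≡ Σ[< n ] f * c
Σ-*ʳ f c = trans (Σ≡sum (λ k → f k * c)) (trans (sym (*-distribʳ-sum c f)) (cong (_* c) (sym (Σ≡sum f))))

Σ-comm-*ˡ : ∀ {m n} (f : Fin m → ℕ) (g : Fin m → Fin n → ℕ) →
  Σ[< n ] (λ j → Σ[< m ] (λ k → f k * g k j)) ≡ Σ[< m ] (λ k → f k * Σ[< n ] (g k))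
Σ-comm-*ˡ {m} {n} f g = begin
  Σ[< n ] (λ j → Σ[< m ] (λ k → f k * g k j))  ≡⟨ Σ≡sum (λ j → Σ[< m ] (λ k → f k * g k j)) ⟩
  sum (λ j → Σ[< m ] (λ k → f k * g k j))      ≡⟨ sum-cong-≗ (λ j → Σ≡sum (λ k → f k * g k j)) ⟩
  sum (λ j → sum (λ k → f k * g k j))          ≡⟨ sym (∑-comm (λ k j → f k * g k j)) ⟩
  sum (λ k → sum (λ j → f k * g k j))          ≡⟨ sum-cong-≗ (λ k → sym (*-distribˡ-sum (f k) (g k))) ⟩
  sum (λ k → f k * sum (g k))                  ≡⟨ sum-cong-≗ (λ k → cong (f k *_) (sym (Σ≡sum (g k)))) ⟩
  sum (λ k → f k * Σ[< n ] (g k))              ≡⟨ sym (Σ≡sum (λ k → f k * Σ[< n ] (g k))) ⟩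
  Σ[< m ] (λ k → f k * Σ[< n ] (g k))          ∎
  where open ≡-Reasoning

Σ-permute : ∀ {m n} (f : Fin n → ℕ) (π : Permutation m n) →
  Σ[< n ] f ≡ Σ[< m ] (f ∘ (π ⟨$⟩ʳ_))
Σ-permute f π = trans (Σ≡sum f) (trans (sum-permute f π) (sym (Σ≡sum (f ∘ (π ⟨$⟩ʳ_)))))

count : ∀ {n} → (Fin n → Bool) → ℕ
count {n} p = Σ[< n ] (indicator ∘ p)

count-complement : ∀ {n} (p : Fin n → Bool) → count p + count (not ∘ p) ≡ n
count-complement {zero}  p = refl
count-complement {suc n} p with p zero
... | true  = cong suc (count-complement (p ∘ suc))
... | false = trans (+-suc _ _) (cong suc (count-complement (p ∘ suc)))

count≡0⇔all-false : ∀ {n} (p : Fin n → Bool) → count p ≡ 0 ⇔ (∀ k → p k ≡ false)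
count≡0⇔all-false p = mk⇔ (to p) (from p)
  where
  to : ∀ {n} (p : Fin n → Bool) → count p ≡ 0 → ∀ k → p k ≡ false
  to {suc n} p count≡0 k with p zero in p₀
  to {suc n} p ()      k       | true
  to {suc n} p count≡0 zero    | false = p₀
  to {suc n} p count≡0 (suc k) | false = to (p ∘ suc) count≡0 k

  from : ∀ {n} (p : Fin n → Bool) → (∀ k → p k ≡ false) → count p ≡ 0
  from {zero}  p all-false = refl
  from {suc n} p all-false rewrite all-false zero = from (p ∘ suc) (all-false ∘ suc)

count≡1⇔∃! : ∀ {n} (p : Fin n → Bool) → count p ≡ 1 ⇔ ∃! _≡_ (λ k → p k ≡ true)
count≡1⇔∃! p = mk⇔ (to p) (from p)
  where
  to : ∀ {n} (p : Fin n → Bool) → count p ≡ 1 → ∃! _≡_ (λ k → p k ≡ true)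
  to {suc n} p count≡1 with p zero in p₀
  ... | true  = zero , p₀ , only-zero
    where
    only-zero : ∀ {k} → p k ≡ true → zero ≡ k
    only-zero {zero}  _  = refl
    only-zero {suc k} pk =
      ⊥-elim (not-¬ pk (Equivalence.to (count≡0⇔all-false (p ∘ suc)) (ℕ.suc-injective count≡1) k))
  ... | false with to (p ∘ suc) count≡1
  ...   | k , pk , unique = suc k , pk , only-suc-k
    where
    only-suc-k : ∀ {k′} → p k′ ≡ true → suc k ≡ k′
    only-suc-k {zero}   p₀′ = ⊥-elim (not-¬ p₀′ p₀)
    only-suc-k {suc k′} pk′ = cong suc (unique pk′)

  from : ∀ {n} (p : Fin n → Bool) → ∃! _≡_ (λ k → p k ≡ true) → count p ≡ 1
  from {suc n} p (zero , p₀ , unique) rewrite p₀ =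
    cong suc (Equivalence.from (count≡0⇔all-false (p ∘ suc)) (λ k → ¬-not (0≢1+n ∘ unique)))
  from {suc n} p (suc k , pk , unique) rewrite ¬-not (0≢1+n ∘ sym ∘ unique {zero}) =
    from (p ∘ suc) (k , pk , suc-injective ∘ unique)

module _ {c ℓ : Level} (FG : FiniteGroup c ℓ) where
  open FiniteGroup FG renaming (sym to ≈-sym; trans to ≈-trans; reflexive to ≈-reflexive)
  open GroupProperties group using (\\-leftDividesˡ; \\-leftDividesʳ; ∙-cancelˡ)

  index : Carrier → Fin n
  index x = proj₁ (enum-sur x)

  enum-index : ∀ x → enum (index x) ≈ x
  enum-index x = proj₂ (enum-sur x)

  index-unique : ∀ {k x} → enum k ≈ x → index x ≡ k
  index-unique {k} {x} k≈x = enum-inj _ _ (≈-trans (enum-index x) (≈-sym k≈x))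

  enum-index-\\ : ∀ a s → a ⁻¹ ∙ enum (index (a ∙ s)) ≈ s
  enum-index-\\ a s = ≈-trans (∙-congˡ (enum-index (a ∙ s))) (\\-leftDividesʳ a s)

  index-∙ : ∀ {a s k} → a ⁻¹ ∙ enum k ≈ s → index (a ∙ s) ≡ k
  index-∙ {a} {k = k} a\\k≈s = index-unique (≈-trans (≈-sym (\\-leftDividesˡ a (enum k))) (∙-congˡ a\\k≈s))

  x⁻¹y∙y⁻¹z≈x⁻¹z : ∀ x y z → (x ⁻¹ ∙ y) ∙ (y ⁻¹ ∙ z) ≈ x ⁻¹ ∙ z
  x⁻¹y∙y⁻¹z≈x⁻¹z x y z = ≈-trans (assoc _ _ _) (∙-congˡ (\\-leftDividesˡ y z))

  leftDivision : Carrier → Permutation n n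
  leftDivision a = permutation (λ k → index (a ⁻¹ ∙ enum k)) (λ k → index (a ∙ enum k))
    (λ k → index-unique (≈-sym (enum-index-\\ a (enum k))))
    (λ k → index-∙ (≈-sym (enum-index (a ⁻¹ ∙ enum k))))

  rowSum-A : ∀ {X} → Respects FG X → ∀ i → Σ[< n ] (A FG X i) ≡ card FG X
  rowSum-A {X} X-resp i = sym (begin
    Σ[< n ] (indicator ∘ X ∘ enum)
      ≡⟨ Σ-permute _ (leftDivision (enum i)) ⟩
    Σ[< n ] (λ j → indicator (X (enum (index (enum i ⁻¹ ∙ enum j)))))
      ≡⟨ Σ-cong {n} (λ j → cong indicator (X-resp _ _ (enum-index (enum i ⁻¹ ∙ enum j)))) ⟩
    Σ[< n ] (A FG X i)
      ∎)
    where open ≡-Reasoning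

  U-resp : Respects FG (U FG)
  U-resp x y x≈y = cong not (does-⇔ (mk⇔ (≈-trans (≈-sym x≈y)) (≈-trans x≈y)) (x ≟ ε) (y ≟ ε))

  card-U : card FG (U FG) ≡ n ∸ 1
  card-U = begin
    card FG (U FG)                     ≡⟨ m+n∸m≡n 1 _ ⟨
    1 + card FG (U FG) ∸ 1             ≡⟨ cong (λ m → m + card FG (U FG) ∸ 1) ε-once ⟨
    count isε + count (not ∘ isε) ∸ 1  ≡⟨ cong (_∸ 1) (count-complement isε) ⟩
    n ∸ 1                              ∎
    where
    open ≡-Reasoning
    isε : Fin n → Bool
    isε k = does (enum k ≟ ε)
    unique : ∀ {k} → isε k ≡ true → index ε ≡ k
    unique {k} _ with enum k ≟ ε
    ... | yes k≈ε = index-unique k≈ε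
    unique () | no _
    ε-once : count isε ≡ 1
    ε-once = Equivalence.from (count≡1⇔∃! isε) (index ε , dec-true (_ ≟ ε) (enum-index ε) , unique)

  U-ε : ∀ {x} → x ≈ ε → U FG x ≡ false
  U-ε {x} x≈ε = cong not (dec-true (x ≟ ε) x≈ε)

  U-≉ε : ∀ {x} → ¬ x ≈ ε → U FG x ≡ true
  U-≉ε {x} x≉ε = cong not (dec-false (x ≟ ε) x≉ε)

  card-⊗ : ∀ {X Y Z} → Respects FG X → Respects FG Y → Respects FG Z →
    _≡ᴹ_ FG (A FG Z) (_⊗_ FG (A FG X) (A FG Y)) → card FG X * card FG Y ≡ card FG Z
  card-⊗ {X} {Y} {Z} X-resp Y-resp Z-resp AZ≡AX⊗AY = begin
    card FG X * card FG Y
      ≡⟨ cong (_* card FG Y) (rowSum-A X-resp i) ⟨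
    Σ[< n ] (A FG X i) * card FG Y
      ≡⟨ Σ-*ʳ (A FG X i) (card FG Y) ⟨
    Σ[< n ] (λ k → A FG X i k * card FG Y)
      ≡⟨ Σ-cong {n} (λ k → cong (A FG X i k *_) (rowSum-A Y-resp k)) ⟨
    Σ[< n ] (λ k → A FG X i k * Σ[< n ] (A FG Y k))
      ≡⟨ Σ-comm-*ˡ (A FG X i) (A FG Y) ⟨
    Σ[< n ] (_⊗_ FG (A FG X) (A FG Y) i)
      ≡⟨ Σ-cong {n} (AZ≡AX⊗AY i) ⟨
    Σ[< n ] (A FG Z i)
      ≡⟨ rowSum-A Z-resp i ⟩
    card FG Z
      ∎
    where
    open ≡-Reasoning
    i : Fin n
    i = index ε

  module Factorizations (S T : Subset FG) where

    Factorization : Carrier → Carrier → Carrier → Set ℓ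
    Factorization s t x = S s ≡ true × T t ≡ true × s ∙ t ≈ x

    NotFactorizable : Carrier → Set (c ⊔ ℓ)
    NotFactorizable x = ∀ s t → S s ≡ true → T t ≡ true → ¬ (s ∙ t ≈ x)

    UniquelyFactorizable : Carrier → Set (c ⊔ ℓ)
    UniquelyFactorizable x = Σ Carrier λ s → Σ Carrier λ t → Factorization s t x
      × (∀ s′ t′ → S s′ ≡ true → T t′ ≡ true → s′ ∙ t′ ≈ x → s′ ≈ s × t′ ≈ t)

    NotFactorizable-resp : ∀ {x y} → x ≈ y → NotFactorizable x → NotFactorizable y
    NotFactorizable-resp x≈y none s t s∈S t∈T st≈y = none s t s∈S t∈T (≈-trans st≈y (≈-sym x≈y))

    UniquelyFactorizable-resp : ∀ {x y} → x ≈ y → UniquelyFactorizable x → UniquelyFactorizable y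
    UniquelyFactorizable-resp x≈y (s , t , (s∈S , t∈T , st≈x) , unique) =
      s , t , (s∈S , t∈T , ≈-trans st≈x x≈y) ,
      λ s′ t′ s′∈S t′∈T s′t′≈y → unique s′ t′ s′∈S t′∈T (≈-trans s′t′≈y (≈-sym x≈y))

    second-factor-unique : ∀ {s t s′ t′ x} → s ∙ t ≈ x → s′ ∙ t′ ≈ x → s ≈ s′ → t ≈ t′
    second-factor-unique {s} {t} {t′ = t′} st≈x s′t′≈x s≈s′ =
      ∙-cancelˡ s t t′ (≈-trans st≈x (≈-trans (≈-sym s′t′≈x) (∙-congʳ (≈-sym s≈s′))))

    through : Carrier → Carrier → Fin n → Bool
    through a b k = S (a ⁻¹ ∙ enum k) ∧ T (enum k ⁻¹ ∙ b)

    ⊗-entry : ∀ i j → _⊗_ FG (A FG S) (A FG T) i j ≡ count (through (enum i) (enum j))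
    ⊗-entry i j = Σ-cong {n} (λ k → indicator-∧ (S (enum i ⁻¹ ∙ enum k)) (T (enum k ⁻¹ ∙ enum j)))

    through⇒Factorization : ∀ {a b k} → through a b k ≡ true →
      Factorization (a ⁻¹ ∙ enum k) (enum k ⁻¹ ∙ b) (a ⁻¹ ∙ b)
    through⇒Factorization {a} {b} {k} through≡true with Equivalence.to (∧≡true⇔ _ _) through≡true
    ... | s∈S , t∈T = s∈S , t∈T , x⁻¹y∙y⁻¹z≈x⁻¹z a (enum k) b

    NotFactorizable-ε⇒Disjoint : NotFactorizable ε → Symmetric FG T → Disjoint FG S T
    NotFactorizable-ε⇒Disjoint none T-sym x x∈S =
      ¬-not λ x∈T → none x (x ⁻¹) x∈S (trans (T-sym x) x∈T) (inverseʳ x)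

    module _ (S-resp : Respects FG S) (T-resp : Respects FG T) where

      Factorization⇒through : ∀ {a b s t} → Factorization s t (a ⁻¹ ∙ b) →
        through a b (index (a ∙ s)) ≡ true
      Factorization⇒through {a} {b} {s} {t} (s∈S , t∈T , st≈a\\b) =
        Equivalence.from (∧≡true⇔ _ _) (trans (S-resp _ _ s′≈s) s∈S , trans (T-resp _ _ t′≈t) t∈T)
        where
        s′≈s : a ⁻¹ ∙ enum (index (a ∙ s)) ≈ s
        s′≈s = enum-index-\\ a s
        t′≈t : enum (index (a ∙ s)) ⁻¹ ∙ b ≈ t
        t′≈t = second-factor-unique (x⁻¹y∙y⁻¹z≈x⁻¹z a _ b) st≈a\\b s′≈s

      count-through≡0⇔ : ∀ a b → count (through a b) ≡ 0 ⇔ NotFactorizable (a ⁻¹ ∙ b)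
      count-through≡0⇔ a b = mk⇔ to from
        where
        to : count (through a b) ≡ 0 → NotFactorizable (a ⁻¹ ∙ b)
        to count≡0 s t s∈S t∈T st≈a⁻¹b =
          not-¬ (Factorization⇒through (s∈S , t∈T , st≈a⁻¹b))
                (Equivalence.to (count≡0⇔all-false (through a b)) count≡0 (index (a ∙ s)))

        from : NotFactorizable (a ⁻¹ ∙ b) → count (through a b) ≡ 0
        from none = Equivalence.from (count≡0⇔all-false (through a b)) λ k → ¬-not λ through≡true →
          let s∈S , t∈T , st≈a⁻¹b = through⇒Factorization through≡true in none _ _ s∈S t∈T st≈a⁻¹b

      count-through≡1⇔ : ∀ a b → count (through a b) ≡ 1 ⇔ UniquelyFactorizable (a ⁻¹ ∙ b)
      count-through≡1⇔ a b = mk⇔ to from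
        where
        to : count (through a b) ≡ 1 → UniquelyFactorizable (a ⁻¹ ∙ b)
        to count≡1 with Equivalence.to (count≡1⇔∃! (through a b)) count≡1
        ... | k , through≡true , unique = a ⁻¹ ∙ enum k , enum k ⁻¹ ∙ b , factorization , only
          where
          factorization : Factorization (a ⁻¹ ∙ enum k) (enum k ⁻¹ ∙ b) (a ⁻¹ ∙ b)
          factorization = through⇒Factorization through≡true

          only : ∀ s′ t′ → S s′ ≡ true → T t′ ≡ true → s′ ∙ t′ ≈ a ⁻¹ ∙ b →
            s′ ≈ a ⁻¹ ∙ enum k × t′ ≈ enum k ⁻¹ ∙ b
          only s′ t′ s′∈S t′∈T s′t′≈a⁻¹b =
            s′≈s , second-factor-unique s′t′≈a⁻¹b (proj₂ (proj₂ factorization)) s′≈s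
            where
            k≡index : k ≡ index (a ∙ s′)
            k≡index = unique (Factorization⇒through (s′∈S , t′∈T , s′t′≈a⁻¹b))
            s′≈s : s′ ≈ a ⁻¹ ∙ enum k
            s′≈s = ≈-trans (≈-sym (enum-index-\\ a s′)) (≈-reflexive (cong (λ m → a ⁻¹ ∙ enum m) (sym k≡index)))

        from : UniquelyFactorizable (a ⁻¹ ∙ b) → count (through a b) ≡ 1
        from (s , t , factorization , unique) = Equivalence.from (count≡1⇔∃! (through a b))
          (index (a ∙ s) , Factorization⇒through factorization , λ through≡true →
            let s′∈S , t′∈T , s′t′≈a⁻¹b = through⇒Factorization through≡true
            in index-∙ (proj₁ (unique _ _ s′∈S t′∈T s′t′≈a⁻¹b)))

      A-U≡⊗⇒NearFactorization : S ε ≡ false → T ε ≡ false →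
        _≡ᴹ_ FG (A FG (U FG)) (_⊗_ FG (A FG S) (A FG T)) → NearFactorization FG S T
      A-U≡⊗⇒NearFactorization Sε Tε AU≡AS⊗AT = (Sε , Tε) , unique , none
        where
        entry : ∀ i j → indicator (U FG (enum i ⁻¹ ∙ enum j)) ≡ count (through (enum i) (enum j))
        entry i j = trans (AU≡AS⊗AT i j) (⊗-entry i j)

        e : Carrier
        e = enum (index ε)

        none : NotFactorizable ε
        none = NotFactorizable-resp (inverseˡ e) (Equivalence.to (count-through≡0⇔ e e)
          (trans (sym (entry (index ε) (index ε))) (cong indicator (U-ε (inverseˡ e)))))

        unique : ∀ g → ¬ g ≈ ε → UniquelyFactorizable g
        unique g g≉ε =
          UniquelyFactorizable-resp (enum-index-\\ e g) (Equivalence.to (count-through≡1⇔ e _)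
            (trans (sym (entry (index ε) (index (e ∙ g))))
                   (cong indicator (U-≉ε (g≉ε ∘ ≈-trans (≈-sym (enum-index-\\ e g)))))))

      NearFactorization⇒A-U≡⊗ : NearFactorization FG S T →
        _≡ᴹ_ FG (A FG (U FG)) (_⊗_ FG (A FG S) (A FG T))
      NearFactorization⇒A-U≡⊗ (_ , unique , none) i j =
        trans (entry ((enum i ⁻¹ ∙ enum j) ≟ ε)) (sym (⊗-entry i j))
        where
        entry : Dec (enum i ⁻¹ ∙ enum j ≈ ε) →
          indicator (U FG (enum i ⁻¹ ∙ enum j)) ≡ count (through (enum i) (enum j))
        entry (yes x≈ε) = trans (cong indicator (U-ε x≈ε))
          (sym (Equivalence.from (count-through≡0⇔ _ _) (NotFactorizable-resp (≈-sym x≈ε) none)))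
        entry (no x≉ε) = trans (cong indicator (U-≉ε x≉ε))
          (sym (Equivalence.from (count-through≡1⇔ _ _) (unique _ x≉ε)))

mainTheorem2 : {c ℓ : Level} (FG : FiniteGroup c ℓ) (S T : Subset FG) →
    Respects FG S → Respects FG T →
    Symmetric FG S → Symmetric FG T →
    S (FiniteGroup.ε FG) ≡ false → T (FiniteGroup.ε FG) ≡ false →
    ((_≡ᴹ_ FG (A FG (U FG)) (_⊗_ FG (A FG S) (A FG T))) ⇔ SymmetricNearFactorization FG S T)
    × ((_≡ᴹ_ FG (A FG (U FG)) (_⊗_ FG (A FG S) (A FG T))) →
         (card FG S * card FG T ≡ FiniteGroup.n FG ∸ 1) × Disjoint FG S T)
mainTheorem2 FG S T S-resp T-resp S-sym T-sym Sε Tε =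
    mk⇔ (λ AU≡AS⊗AT → nearFactorization AU≡AS⊗AT , S-sym , T-sym)
        (NearFactorization⇒A-U≡⊗ S-resp T-resp ∘ proj₁)
  , λ AU≡AS⊗AT →
        trans (card-⊗ FG S-resp T-resp (U-resp FG) AU≡AS⊗AT) (card-U FG)
      , NotFactorizable-ε⇒Disjoint (proj₂ (proj₂ (nearFactorization AU≡AS⊗AT))) T-sym
  where
  open Factorizations FG S T
  nearFactorization : _≡ᴹ_ FG (A FG (U FG)) (_⊗_ FG (A FG S) (A FG T)) → NearFactorization FG S T
  nearFactorization = A-U≡⊗⇒NearFactorization S-resp T-resp Sε Tε
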